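{- Let $n \ge 1$ be an integer and let $f \in \mathcal{P}_n$. Then there exists $g \in R$ with $g^n \equiv f \pmod{\mu_n}$, and $g$ is unique modulo $\mu_n/n$: the set of all $g \in R$ with $g^n \equiv f \pmod{\mu_n}$ is exactly one congruence class of elements of $R$ modulo $\mu_n/n$.
   Context: $R := 1 + x\mathbb{Z}[[x]]$ is the set of formal power series with integer coefficients and constant term $1$. For an integer $n \ge 1$, $\mathcal{P}_n := \{ g^n \mid g \in R\}$, and $\mu_n := n \prod_{p \mid n} p$ (product over the primes dividing $n$). For power series $a, b$ with integer coefficients and an integer $m$, $a \equiv b \pmod{m}$ means every coefficient of $a-b$ is divisible by $m$. -}

module Defs where

open import Data.Nat as ℕ using (ℕ; zero; suc; NonZero)
open import Data.Nat.Divisibility as ℕD using (_∣?_)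
open import Data.Nat.Primality using (Prime; prime?)
open import Data.Integer as ℤ using (ℤ; +_)
open import Data.Integer.Divisibility as ℤD using ()
open import Data.List using (List; []; _∷_; filter; upTo; map)
open import Data.Nat.ListAction using (product)
open import Data.Product using (Σ; _×_; _,_)
open import Relation.Nullary.Decidable using (_×-dec_)
open import Relation.Binary.PropositionalEquality using (_≡_)

PS : Set
PS = ℕ → ℤ

sumTo : ℕ → (ℕ → ℤ) → ℤ
sumTo zero f = f 0
sumTo (suc k) f = sumTo k f ℤ.+ f (suc k)

_·_ : PS → PS → PS
(a · b) k = sumTo k (λ i → a i ℤ.* b (k ℕ.∸ i))

one : PS
one zero = + 1
one (suc _) = + 0

_^ₚ_ : PS → ℕ → PS
g ^ₚ zero = one
g ^ₚ suc n = g · (g ^ₚ n)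

-- membership in R = 1 + xZ[[x]]
InR : PS → Set
InR f = f 0 ≡ + 1

InP : ℕ → PS → Set
InP n f = Σ PS λ g → InR g × (∀ k → f k ≡ (g ^ₚ n) k)

_≡ₚ_[mod_] : PS → PS → ℕ → Set
a ≡ₚ b [mod m ] = ∀ k → (+ m) ℤD.∣ (a k ℤ.- b k)

-- product of the primes dividing n (for n ≥ 1, primes p ∣ n satisfy p ≤ n)
primeDivisors : ℕ → List ℕ
primeDivisors n = filter (λ p → prime? p ×-dec (p ∣? n)) (upTo (suc n))

μ : ℕ → ℕ
μ n = n ℕ.* product (primeDivisors n)

-- If x ≡ y (mod c) in a commutative semiring, say x = y + c d, then
-- x^m = y^m + m c d y^(m-1) + c² w, so x^m ≡ y^m (mod c m) as soon as m ∣ c. Applying this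
-- along the prime factorisation of n, every prime of which divides c = rad n, turns
-- g ≡ h (mod rad n) into g^n ≡ h^n (mod n rad n) = (mod μ n); note μ n / n = rad n.
-- Conversely let g, h ∈ R with g^n ≡ h^n (mod μ n) and g ≡ h (mod rad n) in all degrees
-- up to k. The series s that agrees with g up to degree k and with h afterwards satisfies
-- s ≡ h (mod rad n), hence s^n ≡ h^n ≡ g^n (mod μ n). Since s and g have constant term 1
-- and agree up to degree k, the coefficients of g^n and s^n in degree k + 1 differ by
-- exactly n (g_{k+1} - h_{k+1}); cancelling n gives the congruence in degree k + 1.
module Submission where

open import Defs
open import Algebra.Bundles using (CommutativeSemiring)
open import Data.List using ([]; _∷_)
open import Data.List.Membership.Propositional using (_∈_)
open import Data.List.Relation.Unary.All as All using (All; []; _∷_)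
open import Data.Nat as ℕ using (ℕ; zero; suc; _∸_; _≤_; _<_; _≤?_; NonZero; _/_)
import Data.Nat.Properties as ℕ
open import Data.Nat.Divisibility as ℕ using (_∣_; divides; ∣-trans; m∣m*n; _∣0; _∣?_)
open import Data.Nat.ListAction using (product)
open import Data.Nat.ListAction.Properties using (∈⇒∣product)
open import Data.Nat.Primality using (Prime; prime?)
open import Data.Nat.Primality.Factorisation using (factorise; PrimeFactorisation)
open import Data.Product using (∃; _,_)
open import Level using (0ℓ; _⊔_)
open import Relation.Binary.PropositionalEquality as ≡ using (_≡_)

module PowerCongruence {a ℓ} (S : CommutativeSemiring a ℓ) where

  open CommutativeSemiring S
  open import Algebra.Properties.Semiring.Mult semiring using (_×_; ×-congʳ; ×-assoc-*; ×1-homo-*)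
  open import Algebra.Properties.Semiring.Exp semiring using (_^_; ^-congʳ; ^-assocʳ)
  open import Algebra.Solver.Ring.NaturalCoefficients.Default S using (solve; _:+_; _:*_; _:=_; con)
  open import Relation.Binary.Reasoning.Setoid setoid

  infix 4 _≈_[mod_]
  _≈_[mod_] : Carrier → Carrier → ℕ → Set (a ⊔ ℓ)
  x ≈ y [mod m ] = ∃ λ d → x ≈ y + m × d

  ×≈×1* : ∀ m x → m × x ≈ (m × 1#) * x
  ×≈×1* m x = sym (trans (×-assoc-* m 1# x) (×-congʳ m (*-identityˡ x)))

  ≈[mod]-cong : ∀ {x x′ y y′ m} → x ≈ x′ → y ≈ y′ → x ≈ y [mod m ] → x′ ≈ y′ [mod m ]
  ≈[mod]-cong x≈x′ y≈y′ (d , x≈y+md) = d , trans (sym x≈x′) (trans x≈y+md (+-congʳ y≈y′))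

  ^-first-order-expansion : ∀ {x y c d} → x ≈ y + c * d → ∀ j → ∃ λ w →
    x ^ suc j ≈ y ^ suc j + (suc j × 1#) * (c * d * y ^ j) + c * c * w
  ^-first-order-expansion {x} {y} {c} {d} x≈y+cd zero = 0# , (begin
    x * 1#             ≈⟨ *-congʳ x≈y+cd ⟩
    (y + c * d) * 1#
      ≈⟨ solve 3 (λ y c d → (y :+ c :* d) :* con 1
                   := y :* con 1 :+ (con 1 :+ con 0) :* (c :* d :* con 1) :+ c :* c :* con 0)
                 refl y c d ⟩
    y * 1# + (1# + 0#) * (c * d * 1#) + c * c * 0# ∎)
  ^-first-order-expansion {x} {y} {c} {d} x≈y+cd (suc j) with ^-first-order-expansion x≈y+cd j
  ... | w , xʲ⁺¹≈ = y * w + J * (d * d * Y) + c * d * w , (begin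
    x * x ^ suc j ≈⟨ *-cong x≈y+cd xʲ⁺¹≈ ⟩
    (y + c * d) * (y * Y + J * (c * d * Y) + c * c * w)
      ≈⟨ solve 6 (λ y c d Y w J → (y :+ c :* d) :* (y :* Y :+ J :* (c :* d :* Y) :+ c :* c :* w)
                   := y :* (y :* Y) :+ (con 1 :+ J) :* (c :* d :* (y :* Y))
                        :+ c :* c :* (y :* w :+ J :* (d :* d :* Y) :+ c :* d :* w))
                 refl y c d Y w J ⟩
    y * (y * Y) + (1# + J) * (c * d * (y * Y)) + c * c * (y * w + J * (d * d * Y) + c * d * w) ∎)
    where
    Y = y ^ j
    J = suc j × 1#

  ^-mod-mul : ∀ {x y c m} → m ∣ c → x ≈ y [mod c ] → x ^ m ≈ y ^ m [mod c ℕ.* m ]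
  ^-mod-mul {c = c} {m = zero} _ _ rewrite ℕ.*-zeroʳ c = 0# , sym (+-identityʳ 1#)
  ^-mod-mul {x} {y} {m = suc j} (divides e ≡.refl) (d , x≈y+cd)
    with ^-first-order-expansion (trans x≈y+cd (+-congˡ (×≈×1* (e ℕ.* suc j) d))) j
  ... | w , expansion = d * Y + E * w , (begin
    x ^ suc j                                   ≈⟨ expansion ⟩
    y ^ suc j + M * (C * d * Y) + C * C * w     ≈⟨ +-congˡ (*-congʳ (*-congˡ C≈EM)) ⟩
    y ^ suc j + M * (C * d * Y) + C * (E * M) * w
      ≈⟨ solve 7 (λ yᵐ M C d Y E w → yᵐ :+ M :* (C :* d :* Y) :+ C :* (E :* M) :* w
                                   := yᵐ :+ C :* M :* (d :* Y :+ E :* w)) refl (y ^ suc j) M C d Y E w ⟩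
    y ^ suc j + C * M * (d * Y + E * w)
      ≈⟨ +-congˡ (sym (trans (×≈×1* (c ℕ.* suc j) _) (*-congʳ (×1-homo-* c (suc j))))) ⟩
    y ^ suc j + (c ℕ.* suc j) × (d * Y + E * w) ∎)
    where
    c = e ℕ.* suc j
    Y = y ^ j
    M = suc j × 1#
    E = e × 1#
    C = c × 1#
    C≈EM : C ≈ E * M
    C≈EM = ×1-homo-* e (suc j)

  ^-mod-product : ∀ {x y c} ps → All (_∣ c) ps → x ≈ y [mod c ] →
                    x ^ product ps ≈ y ^ product ps [mod c ℕ.* product ps ]
  ^-mod-product {x} {y} {c} [] [] (d , x≈y+cd) rewrite ℕ.*-identityʳ c =
    d , trans (*-identityʳ x) (trans x≈y+cd (+-congʳ (sym (*-identityʳ y))))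
  ^-mod-product {x} {y} {c} (p ∷ ps) (p∣c ∷ ps∣c) x≡y =
    ≡.subst (x ^ (p ℕ.* P) ≈ y ^ (p ℕ.* P) [mod_]) (reorder c P p)
      (≈[mod]-cong {m = c ℕ.* P ℕ.* p} (reassoc x) (reassoc y)
        (^-mod-mul (∣-trans p∣c (m∣m*n P)) (^-mod-product ps ps∣c x≡y)))
    where
    P = product ps
    reassoc : ∀ z → (z ^ P) ^ p ≈ z ^ (p ℕ.* P)
    reassoc z = trans (^-assocʳ z P p) (^-congʳ z (ℕ.*-comm P p))
    reorder : ∀ c P p → c ℕ.* P ℕ.* p ≡ c ℕ.* (p ℕ.* P)
    reorder c P p = ≡.trans (ℕ.*-assoc c P p) (≡.cong (c ℕ.*_) (ℕ.*-comm P p))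

  ^-mod-prime-factors : ∀ {x y} c n .{{_ : NonZero n}} → (∀ {p} → Prime p → p ∣ n → p ∣ c) →
                    x ≈ y [mod c ] → x ^ n ≈ y ^ n [mod c ℕ.* n ]
  ^-mod-prime-factors {x} {y} c n primes∣c x≡y =
    ≡.subst (λ k → x ^ k ≈ y ^ k [mod c ℕ.* k ]) (≡.sym n≡Πps)
      (^-mod-product ps (All.tabulate factor∣c) x≡y)
    where
    open PrimeFactorisation (factorise n) renaming (factors to ps; isFactorisation to n≡Πps)
    factor∣c : ∀ {p} → p ∈ ps → p ∣ c
    factor∣c p∈ps =
      primes∣c (All.lookup factorsPrime p∈ps) (≡.subst (_ ∣_) (≡.sym n≡Πps) (∈⇒∣product p∈ps))

-- Imported only here: their operators would clash with the semiring's in PowerCongruence.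
open import Algebra.Structures using (IsCommutativeSemiring)
open import Algebra.Structures.Biased using (isCommutativeSemiringˡ)
open import Algebra.Consequences.Setoid using (comm∧idˡ⇒id)
import Algebra.Construct.Pointwise as Pointwise
open import Data.Nat.DivMod using (m*n/n≡m)
open import Data.Nat.Induction using (<-rec)
open import Data.Integer as ℤ using (ℤ; +_; _+_; _*_; _-_)
import Data.Integer.Properties as ℤ
import Data.Integer.Divisibility as ℤ
import Data.Integer.Divisibility.Signed as ℤˢ
open import Data.Integer.Tactic.RingSolver using (solve-∀)
open import Data.List.Membership.Propositional.Properties using (∈-upTo⁺; ∈-filter⁺)
open import Data.Product using (Σ; _×_)
open import Function using (_∘_)
open import Function.Bundles using (_⇔_; mk⇔)
open import Function.Construct.Composition using (_⇔-∘_)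
open import Relation.Nullary using (yes; no; contradiction)
open import Relation.Nullary.Decidable using (_×-dec_)
open ≡ using (refl; sym; trans; cong; cong₂; subst; subst₂; _≗_; isEquivalence; _→-setoid_; module ≡-Reasoning)

sumTo-cong≤ : ∀ k {f g : ℕ → ℤ} → (∀ i → i ≤ k → f i ≡ g i) → sumTo k f ≡ sumTo k g
sumTo-cong≤ zero    f≗g = f≗g 0 ℕ.z≤n
sumTo-cong≤ (suc k) f≗g =
  cong₂ _+_ (sumTo-cong≤ k (λ i i≤k → f≗g i (ℕ.m≤n⇒m≤1+n i≤k))) (f≗g (suc k) ℕ.≤-refl)

sumTo-cong : ∀ k {f g : ℕ → ℤ} → f ≗ g → sumTo k f ≡ sumTo k g
sumTo-cong k f≗g = sumTo-cong≤ k (λ i _ → f≗g i)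

sumTo-zero : ∀ k → sumTo k (λ _ → + 0) ≡ + 0
sumTo-zero zero    = refl
sumTo-zero (suc k) = cong (_+ + 0) (sumTo-zero k)

sumTo-+ : ∀ k (f g : ℕ → ℤ) → sumTo k (λ i → f i + g i) ≡ sumTo k f + sumTo k g
sumTo-+ zero    f g = refl
sumTo-+ (suc k) f g = begin
  sumTo k (λ i → f i + g i) + (f (suc k) + g (suc k))
    ≡⟨ cong (_+ (f (suc k) + g (suc k))) (sumTo-+ k f g) ⟩
  (sumTo k f + sumTo k g) + (f (suc k) + g (suc k))
    ≡⟨ interchange (sumTo k f) (sumTo k g) (f (suc k)) (g (suc k)) ⟩
  (sumTo k f + f (suc k)) + (sumTo k g + g (suc k)) ∎
  where
  open ≡-Reasoning
  open import Algebra.Properties.CommutativeSemigroup ℤ.+-commutativeSemigroup using (interchange)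

sumTo-*ˡ : ∀ k c (f : ℕ → ℤ) → c * sumTo k f ≡ sumTo k (λ i → c * f i)
sumTo-*ˡ zero    c f = refl
sumTo-*ˡ (suc k) c f =
  trans (ℤ.*-distribˡ-+ c (sumTo k f) (f (suc k))) (cong (_+ c * f (suc k)) (sumTo-*ˡ k c f))

sumTo-suc : ∀ k (f : ℕ → ℤ) → sumTo (suc k) f ≡ f 0 + sumTo k (f ∘ suc)
sumTo-suc zero    f = refl
sumTo-suc (suc k) f =
  trans (cong (_+ f (suc (suc k))) (sumTo-suc k f)) (ℤ.+-assoc (f 0) (sumTo k (f ∘ suc)) (f (suc (suc k))))

sumTo-diff : ∀ k {f g : ℕ → ℤ} → (∀ i → 1 ≤ i → i ≤ k → f i ≡ g i) →
             sumTo k g - sumTo k f ≡ g 0 - f 0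
sumTo-diff zero    _   = refl
sumTo-diff (suc k) {f} {g} f≗g = begin
  (sumTo k g + g (suc k)) - (sumTo k f + f (suc k))
    ≡⟨ cong (λ z → (sumTo k g + z) - (sumTo k f + f (suc k))) (sym (f≗g (suc k) (ℕ.s≤s ℕ.z≤n) ℕ.≤-refl)) ⟩
  (sumTo k g + f (suc k)) - (sumTo k f + f (suc k))
    ≡⟨ cancel (sumTo k g) (sumTo k f) (f (suc k)) ⟩
  sumTo k g - sumTo k f
    ≡⟨ sumTo-diff k (λ i 1≤i i≤k → f≗g i 1≤i (ℕ.m≤n⇒m≤1+n i≤k)) ⟩
  g 0 - f 0 ∎
  where
  open ≡-Reasoning
  cancel : ∀ a b c → (a + c) - (b + c) ≡ a - b
  cancel = solve-∀

Conv : ℕ → (ℕ → ℕ → ℤ) → ℤ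
Conv k F = sumTo k (λ i → F i (k ∸ i))

conv-cong : ∀ k {F G : ℕ → ℕ → ℤ} → (∀ i j → F i j ≡ G i j) → Conv k F ≡ Conv k G
conv-cong k F≗G = sumTo-cong k (λ i → F≗G i (k ∸ i))

conv-suc : ∀ k (F : ℕ → ℕ → ℤ) → Conv (suc k) F ≡ F 0 (suc k) + Conv k (F ∘ suc)
conv-suc k F = sumTo-suc k _

conv-sucʳ : ∀ k (F : ℕ → ℕ → ℤ) → Conv (suc k) F ≡ Conv k (λ i j → F i (suc j)) + F (suc k) 0
conv-sucʳ k F rewrite ℕ.n∸n≡0 k =
  cong (_+ F (suc k) 0) (sumTo-cong≤ k (λ i i≤k → cong (F i) (ℕ.+-∸-assoc 1 i≤k)))

conv-sym : ∀ k (F : ℕ → ℕ → ℤ) → Conv k F ≡ Conv k (λ i j → F j i)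
conv-sym zero    F = refl
conv-sym (suc k) F = begin
  Conv (suc k) F                               ≡⟨ conv-sucʳ k F ⟩
  Conv k (λ i j → F i (suc j)) + F (suc k) 0   ≡⟨ cong (_+ F (suc k) 0) (conv-sym k (λ i j → F i (suc j))) ⟩
  Conv k (λ i j → F j (suc i)) + F (suc k) 0   ≡⟨ ℤ.+-comm _ (F (suc k) 0) ⟩
  F (suc k) 0 + Conv k (λ i j → F j (suc i))   ≡⟨ conv-suc k (λ i j → F j i) ⟨
  Conv (suc k) (λ i j → F j i)                 ∎
  where open ≡-Reasoning

conv-assoc : ∀ k (F : ℕ → ℕ → ℕ → ℤ) →
             Conv k (λ i j → Conv i (λ u v → F u v j)) ≡ Conv k (λ u w → Conv w (λ v j → F u v j))
conv-assoc zero    F = refl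
conv-assoc (suc k) F = begin
  Conv (suc k) (λ i j → Conv i (λ u v → F u v j))
    ≡⟨ conv-suc k (λ i j → Conv i (λ u v → F u v j)) ⟩
  F 0 0 (suc k) + Conv k (λ i j → Conv (suc i) (λ u v → F u v j))
    ≡⟨ cong (_+_ (F 0 0 (suc k))) (conv-cong k (λ i j → conv-suc i (λ u v → F u v j))) ⟩
  F 0 0 (suc k) + Conv k (λ i j → F 0 (suc i) j + Conv i (λ u v → F (suc u) v j))
    ≡⟨ cong (_+_ (F 0 0 (suc k))) (sumTo-+ k _ _) ⟩
  F 0 0 (suc k) + (Conv k (λ i j → F 0 (suc i) j) + Conv k (λ i j → Conv i (λ u v → F (suc u) v j)))
    ≡⟨ ℤ.+-assoc (F 0 0 (suc k)) _ _ ⟨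
  (F 0 0 (suc k) + Conv k (λ i j → F 0 (suc i) j)) + Conv k (λ i j → Conv i (λ u v → F (suc u) v j))
    ≡⟨ cong (_+ Conv k (λ i j → Conv i (λ u v → F (suc u) v j))) (conv-suc k (F 0)) ⟨
  Conv (suc k) (F 0) + Conv k (λ i j → Conv i (λ u v → F (suc u) v j))
    ≡⟨ cong (_+_ (Conv (suc k) (F 0))) (conv-assoc k (F ∘ suc)) ⟩
  Conv (suc k) (F 0) + Conv k (λ u w → Conv w (λ v j → F (suc u) v j))
    ≡⟨ conv-suc k (λ u w → Conv w (λ v j → F u v j)) ⟨
  Conv (suc k) (λ u w → Conv w (λ v j → F u v j)) ∎
  where open ≡-Reasoning

infixl 6 _+ₚ_
_+ₚ_ : PS → PS → PS
(a +ₚ b) k = a k + b k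

0ₚ : PS
0ₚ _ = + 0

·-cong : ∀ {a a′ b b′} → a ≗ a′ → b ≗ b′ → a · b ≗ a′ · b′
·-cong a≗a′ b≗b′ k = conv-cong k (λ i j → cong₂ _*_ (a≗a′ i) (b≗b′ j))

·-comm : ∀ a b → a · b ≗ b · a
·-comm a b k = trans (conv-sym k (λ i j → a i * b j)) (conv-cong k (λ i j → ℤ.*-comm (a j) (b i)))

·-assoc : ∀ a b c → (a · b) · c ≗ a · (b · c)
·-assoc a b c k = begin
  Conv k (λ i j → Conv i (λ u v → a u * b v) * c j)
    ≡⟨ conv-cong k (λ i j → trans (ℤ.*-comm _ (c j)) (sumTo-*ˡ i (c j) (λ u → a u * b (i ∸ u)))) ⟩
  Conv k (λ i j → Conv i (λ u v → c j * (a u * b v)))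
    ≡⟨ conv-assoc k (λ u v j → c j * (a u * b v)) ⟩
  Conv k (λ u w → Conv w (λ v j → c j * (a u * b v)))
    ≡⟨ conv-cong k (λ u w → conv-cong w (λ v j → reorder (a u) (b v) (c j))) ⟩
  Conv k (λ u w → Conv w (λ v j → a u * (b v * c j)))
    ≡⟨ conv-cong k (λ u w → sumTo-*ˡ w (a u) (λ v → b v * c (w ∸ v))) ⟨
  Conv k (λ u w → a u * Conv w (λ v j → b v * c j)) ∎
  where
  open ≡-Reasoning
  reorder : ∀ x y z → z * (x * y) ≡ x * (y * z)
  reorder = solve-∀

·-identityˡ : ∀ a → one · a ≗ a
·-identityˡ a zero    = ℤ.*-identityˡ (a 0)
·-identityˡ a (suc k) = begin
  Conv (suc k) (λ i j → one i * a j)       ≡⟨ conv-suc k (λ i j → one i * a j) ⟩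
  + 1 * a (suc k) + Conv k (λ _ j → + 0 * a j) ≡⟨ cong₂ _+_ (ℤ.*-identityˡ (a (suc k))) (sumTo-zero k) ⟩
  a (suc k) + + 0                           ≡⟨ ℤ.+-identityʳ _ ⟩
  a (suc k)                                 ∎
  where open ≡-Reasoning

·-distribʳ : ∀ a b c → (b +ₚ c) · a ≗ b · a +ₚ c · a
·-distribʳ a b c k = trans (conv-cong k (λ i j → ℤ.*-distribʳ-+ (a j) (b i) (c i)))
                           (sumTo-+ k (λ i → b i * a (k ∸ i)) (λ i → c i * a (k ∸ i)))

·-zeroˡ : ∀ a → 0ₚ · a ≗ 0ₚ
·-zeroˡ a k = sumTo-zero k

PS-isCommutativeSemiring : IsCommutativeSemiring _≗_ _+ₚ_ _·_ 0ₚ one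
PS-isCommutativeSemiring = isCommutativeSemiringˡ record
  { +-isCommutativeMonoid = Pointwise.isCommutativeMonoid ℕ ℤ.+-0-isCommutativeMonoid
  ; *-isCommutativeMonoid = record
    { isMonoid = record
      { isSemigroup = record
        { isMagma = record { isEquivalence = Pointwise.isEquivalence ℕ isEquivalence ; ∙-cong = ·-cong }
        ; assoc = ·-assoc
        }
      ; identity = comm∧idˡ⇒id (ℕ →-setoid ℤ) ·-comm {one} ·-identityˡ
      }
    ; comm = ·-comm
    }
  ; distribʳ = ·-distribʳ
  ; zeroˡ = ·-zeroˡ
  }

PS-commutativeSemiring : CommutativeSemiring 0ℓ 0ℓ
PS-commutativeSemiring = record { isCommutativeSemiring = PS-isCommutativeSemiring }

open PowerCongruence PS-commutativeSemiring
open CommutativeSemiring PS-commutativeSemiring using (semiring)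
open import Algebra.Properties.Semiring.Mult semiring using () renaming (_×_ to _×ₚ_)
open import Algebra.Properties.Semiring.Exp semiring using (_^_)

^≗^ₚ : ∀ a n → a ^ n ≗ a ^ₚ n
^≗^ₚ a zero    = λ _ → refl
^≗^ₚ a (suc n) = ·-cong {a} (λ _ → refl) (^≗^ₚ a n)

×ₚ-coeff : ∀ m d k → (m ×ₚ d) k ≡ + m * d k
×ₚ-coeff zero    d k = refl
×ₚ-coeff (suc m) d k = trans (cong (_+_ (d k)) (×ₚ-coeff m d k)) (sym (ℤ.suc-* (+ m) (d k)))

≡ₚ⇒≈[mod] : ∀ {a b m} → a ≡ₚ b [mod m ] → a ≈ b [mod m ]
≡ₚ⇒≈[mod] {a} {b} {m} a≡b = quotient , λ k → begin
  a k                       ≡⟨ split (a k) (b k) ⟩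
  b k + (a k - b k)          ≡⟨ cong (_+_ (b k)) (ℤˢ._∣_.equality (divisibility k)) ⟩
  b k + quotient k * + m     ≡⟨ cong (_+_ (b k)) (trans (ℤ.*-comm (quotient k) (+ m)) (sym (×ₚ-coeff m quotient k))) ⟩
  b k + (m ×ₚ quotient) k     ∎
  where
  open ≡-Reasoning
  divisibility : ∀ k → + m ℤˢ.∣ a k - b k
  divisibility k = ℤˢ.∣ᵤ⇒∣ (a≡b k)
  quotient : PS
  quotient k = ℤˢ._∣_.quotient (divisibility k)
  split : ∀ x y → x ≡ y + (x - y)
  split = solve-∀

≈[mod]⇒≡ₚ : ∀ {a b m} → a ≈ b [mod m ] → a ≡ₚ b [mod m ]
≈[mod]⇒≡ₚ {a} {b} {m} (d , a≈b+md) k = ℤˢ.∣⇒∣ᵤ (ℤˢ.divides (d k) (begin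
  a k - b k                 ≡⟨ cong (_- b k) (trans (a≈b+md k) (cong (_+_ (b k)) (×ₚ-coeff m d k))) ⟩
  (b k + + m * d k) - b k   ≡⟨ cancel (b k) (+ m) (d k) ⟩
  d k * + m                 ∎))
  where
  open ≡-Reasoning
  cancel : ∀ x y z → (x + y * z) - x ≡ z * y
  cancel = solve-∀

infix 4 _≗_upTo_
_≗_upTo_ : PS → PS → ℕ → Set
a ≗ b upTo k = ∀ j → j ≤ k → a j ≡ b j

·-upTo : ∀ {a a′ b b′ k} → a ≗ a′ upTo k → b ≗ b′ upTo k → a · b ≗ a′ · b′ upTo k
·-upTo {a} {a′} {b} {b′} a≗a′ b≗b′ j j≤k = sumTo-cong≤ j λ i i≤j →
  cong₂ _*_ (a≗a′ i (ℕ.≤-trans i≤j j≤k)) (b≗b′ (j ∸ i) (ℕ.≤-trans (ℕ.m∸n≤m j i) j≤k))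

^ₚ-upTo : ∀ {a a′ k} → a ≗ a′ upTo k → ∀ n → a ^ₚ n ≗ a′ ^ₚ n upTo k
^ₚ-upTo a≗a′ zero    _ _ = refl
^ₚ-upTo a≗a′ (suc n)     = ·-upTo a≗a′ (^ₚ-upTo a≗a′ n)

^ₚ-InR : ∀ {a} → InR a → ∀ n → InR (a ^ₚ n)
^ₚ-InR a∈R zero    = refl
^ₚ-InR a∈R (suc n) = cong₂ _*_ a∈R (^ₚ-InR a∈R n)

·-next-coeff : ∀ {a a′ b b′ k} → a ≗ a′ upTo k → b ≗ b′ upTo k →
  (a′ · b′) (suc k) - (a · b) (suc k) ≡ a 0 * (b′ (suc k) - b (suc k)) + (a′ (suc k) - a (suc k)) * b 0
·-next-coeff {a} {a′} {b} {b′} {k} a≗a′ b≗b′ = begin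
  (a′ · b′) (suc k) - (a · b) (suc k)
    ≡⟨ cong₂ _-_ (conv-sucʳ k (λ i j → a′ i * b′ j)) (conv-sucʳ k (λ i j → a i * b j)) ⟩
  (sumTo k f′ + a′ K * b′ 0) - (sumTo k f + a K * b 0)
    ≡⟨ regroup (sumTo k f′) (sumTo k f) (a′ K * b′ 0) (a K * b 0) ⟩
  (sumTo k f′ - sumTo k f) + (a′ K * b′ 0 - a K * b 0)
    ≡⟨ cong (_+ (a′ K * b′ 0 - a K * b 0)) (sumTo-diff k middle) ⟩
  (a′ 0 * b′ K - a 0 * b K) + (a′ K * b′ 0 - a K * b 0)
    ≡⟨ cong₂ (λ α β → (α * b′ K - a 0 * b K) + (a′ K * β - a K * b 0))
             (sym (a≗a′ 0 ℕ.z≤n)) (sym (b≗b′ 0 ℕ.z≤n)) ⟩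
  (a 0 * b′ K - a 0 * b K) + (a′ K * b 0 - a K * b 0)
    ≡⟨ factor (a 0) (b 0) (a K) (a′ K) (b K) (b′ K) ⟩
  a 0 * (b′ K - b K) + (a′ K - a K) * b 0 ∎
  where
  open ≡-Reasoning
  K = suc k
  f f′ : ℕ → ℤ
  f  i = a i * b (suc (k ∸ i))
  f′ i = a′ i * b′ (suc (k ∸ i))
  middle : ∀ i → 1 ≤ i → i ≤ k → f i ≡ f′ i
  middle i 1≤i i≤k = cong₂ _*_ (a≗a′ i i≤k) (b≗b′ (suc (k ∸ i)) (ℕ.∸-monoʳ-< 1≤i i≤k))
  regroup : ∀ s′ s x y → (s′ + x) - (s + y) ≡ (s′ - s) + (x - y)
  regroup = solve-∀
  factor : ∀ a₀ b₀ aK a′K bK b′K →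
           (a₀ * b′K - a₀ * bK) + (a′K * b₀ - aK * b₀) ≡ a₀ * (b′K - bK) + (a′K - aK) * b₀
  factor = solve-∀

^ₚ-next-coeff : ∀ {a a′ k} → InR a → a ≗ a′ upTo k → ∀ n →
  (a′ ^ₚ n) (suc k) - (a ^ₚ n) (suc k) ≡ + n * (a′ (suc k) - a (suc k))
^ₚ-next-coeff a∈R a≗a′ zero    = refl
^ₚ-next-coeff {a} {a′} {k} a∈R a≗a′ (suc n) = begin
  (a′ · (a′ ^ₚ n)) (suc k) - (a · (a ^ₚ n)) (suc k)
    ≡⟨ ·-next-coeff a≗a′ (^ₚ-upTo a≗a′ n) ⟩
  a 0 * ((a′ ^ₚ n) (suc k) - (a ^ₚ n) (suc k)) + Δ * (a ^ₚ n) 0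
    ≡⟨ cong₂ (λ α β → α * ((a′ ^ₚ n) (suc k) - (a ^ₚ n) (suc k)) + Δ * β) a∈R (^ₚ-InR a∈R n) ⟩
  + 1 * ((a′ ^ₚ n) (suc k) - (a ^ₚ n) (suc k)) + Δ * + 1
    ≡⟨ cong (λ δ → + 1 * δ + Δ * + 1) (^ₚ-next-coeff a∈R a≗a′ n) ⟩
  + 1 * (+ n * Δ) + Δ * + 1
    ≡⟨ collect (+ n) Δ ⟩
  + suc n * Δ ∎
  where
  open ≡-Reasoning
  Δ = a′ (suc k) - a (suc k)
  collect : ∀ m δ → + 1 * (m * δ) + δ * + 1 ≡ (+ 1 + m) * δ
  collect = solve-∀

splice : ℕ → PS → PS → PS
splice k a b j with j ≤? k
... | yes _ = a j
... | no  _ = b j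

splice-≤ : ∀ {k j} a b → j ≤ k → splice k a b j ≡ a j
splice-≤ {k} {j} a b j≤k with j ≤? k
... | yes _   = refl
... | no  j≰k = contradiction j≤k j≰k

splice-> : ∀ {k j} a b → k < j → splice k a b j ≡ b j
splice-> {k} {j} a b k<j with j ≤? k
... | yes j≤k = contradiction j≤k (ℕ.<⇒≱ k<j)
... | no  _   = refl

∣m-o⇒∣n-o⇒∣m-n : ∀ {d} m n o → + d ℤ.∣ m - o → + d ℤ.∣ n - o → + d ℤ.∣ m - n
∣m-o⇒∣n-o⇒∣m-n {d} m n o d∣m-o d∣n-o = ℤˢ.∣⇒∣ᵤ (subst (+ d ℤˢ.∣_) (cancel m n o)
  (ℤˢ.∣m∣n⇒∣m-n (ℤˢ.∣ᵤ⇒∣ {+ d} {m - o} d∣m-o) (ℤˢ.∣ᵤ⇒∣ {+ d} {n - o} d∣n-o)))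
  where
  cancel : ∀ m n o → (m - o) - (n - o) ≡ m - n
  cancel = solve-∀

≡ₚ⇒^ₚ≡ₚ : ∀ {a b} c n .{{_ : NonZero n}} → (∀ {p} → Prime p → p ∣ n → p ∣ c) →
        a ≡ₚ b [mod c ] → (a ^ₚ n) ≡ₚ (b ^ₚ n) [mod c ℕ.* n ]
≡ₚ⇒^ₚ≡ₚ {a} {b} c n primes∣c =
  ≈[mod]⇒≡ₚ ∘ ≈[mod]-cong {m = c ℕ.* n} (^≗^ₚ a n) (^≗^ₚ b n)
            ∘ ^-mod-prime-factors c n primes∣c ∘ ≡ₚ⇒≈[mod]

^ₚ≡ₚ⇒≡ₚ : ∀ {g h} c n .{{_ : NonZero n}} → (∀ {p} → Prime p → p ∣ n → p ∣ c) → InR g → InR h →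
          (g ^ₚ n) ≡ₚ (h ^ₚ n) [mod c ℕ.* n ] → g ≡ₚ h [mod c ]
^ₚ≡ₚ⇒≡ₚ {g} {h} c n primes∣c g∈R h∈R gⁿ≡hⁿ k = <-rec (λ k → + c ℤ.∣ g k - h k) step k
  where
  step : ∀ k → (∀ {j} → j < k → + c ℤ.∣ g j - h j) → + c ℤ.∣ g k - h k
  step zero    _     rewrite g∈R | h∈R = c ∣0
  step (suc k) below = ℤ.*-cancelˡ-∣ (+ n) (subst (ℤ._∣ + n * (g K - h K)) cn≡n*c cn∣n[gK-hK])
    where
    K = suc k
    s = splice k g h
    s≡h : s ≡ₚ h [mod c ]
    s≡h j with j ≤? k
    ... | yes j≤k = below (ℕ.s≤s j≤k)
    ... | no  _   = subst (λ x → + c ℤ.∣ x) (sym (ℤ.+-inverseʳ (h j))) (c ∣0)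
    gⁿ-sⁿ : (g ^ₚ n) K - (s ^ₚ n) K ≡ + n * (g K - h K)
    gⁿ-sⁿ = trans (^ₚ-next-coeff (trans (splice-≤ {k} g h ℕ.z≤n) g∈R) (λ _ → splice-≤ g h) n)
                  (cong (λ x → + n * (g K - x)) (splice-> g h ℕ.≤-refl))
    cn∣n[gK-hK] : + (c ℕ.* n) ℤ.∣ + n * (g K - h K)
    cn∣n[gK-hK] = subst (+ (c ℕ.* n) ℤ.∣_) gⁿ-sⁿ
      (∣m-o⇒∣n-o⇒∣m-n ((g ^ₚ n) K) ((s ^ₚ n) K) ((h ^ₚ n) K) (gⁿ≡hⁿ K) (≡ₚ⇒^ₚ≡ₚ c n primes∣c s≡h K))
    cn≡n*c : + (c ℕ.* n) ≡ + n * + c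
    cn≡n*c = trans (cong +_ (ℕ.*-comm c n)) (ℤ.pos-* n c)

^ₚ≡ₚ⇔≡ₚ : ∀ {g h} c n .{{_ : NonZero n}} → (∀ {p} → Prime p → p ∣ n → p ∣ c) → InR g → InR h →
         ((g ^ₚ n) ≡ₚ (h ^ₚ n) [mod c ℕ.* n ]) ⇔ (g ≡ₚ h [mod c ])
^ₚ≡ₚ⇔≡ₚ c n primes∣c g∈R h∈R = mk⇔ (^ₚ≡ₚ⇒≡ₚ c n primes∣c g∈R h∈R) (≡ₚ⇒^ₚ≡ₚ c n primes∣c)

≡ₚ-respʳ : ∀ {a b b′ m} → b ≗ b′ → (a ≡ₚ b [mod m ]) ⇔ (a ≡ₚ b′ [mod m ])
≡ₚ-respʳ {a} {m = m} b≗b′ = mk⇔ (λ a≡b k → subst (λ x → + m ℤ.∣ a k - x) (b≗b′ k) (a≡b k))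
                                (λ a≡b′ k → subst (λ x → + m ℤ.∣ a k - x) (sym (b≗b′ k)) (a≡b′ k))

radical : ℕ → ℕ
radical n = product (primeDivisors n)

prime∣⇒∣radical : ∀ {n p} .{{_ : NonZero n}} → Prime p → p ∣ n → p ∣ radical n
prime∣⇒∣radical {n} p-prime p∣n = ∈⇒∣product
  (∈-filter⁺ (λ p → prime? p ×-dec (p ∣? n)) (∈-upTo⁺ (ℕ.s≤s (ℕ.∣⇒≤ p∣n))) (p-prime , p∣n))

μ≡radical*n : ∀ n → μ n ≡ radical n ℕ.* n
μ≡radical*n n = ℕ.*-comm n (radical n)

μ/n≡radical : ∀ n .{{_ : NonZero n}} → μ n / n ≡ radical n
μ/n≡radical n = trans (cong (_/ n) (μ≡radical*n n)) (m*n/n≡m (radical n) n)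

theorem4 : (n : ℕ) → .{{_ : NonZero n}} → (f : PS) → InR f → InP n f →
    Σ PS λ g₀ → InR g₀ ×
      (∀ (g : PS) → InR g → ((g ^ₚ n) ≡ₚ f [mod μ n ]) ⇔ (g ≡ₚ g₀ [mod μ n / n ]))
theorem4 n f _ (h , h∈R , f≗hⁿ) = h , h∈R , λ g g∈R →
  subst₂ (λ m m′ → ((g ^ₚ n) ≡ₚ f [mod m ]) ⇔ (g ≡ₚ h [mod m′ ]))
         (sym (μ≡radical*n n)) (sym (μ/n≡radical n))
         (^ₚ≡ₚ⇔≡ₚ {g} {h} (radical n) n prime∣⇒∣radical g∈R h∈R ⇔-∘ ≡ₚ-respʳ {g ^ₚ n} f≗hⁿ)
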